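{- Let $A:\mathcal{U}$, $B:A\to\mathcal{U}$, and $W_{AB}$, $\mathsf{sup}$, $\mathsf{rec}_W$, $\mathsf{MorphW}$ as in the context. For all $X:\mathcal{U}$, $g:\prod_{a:A}(B(a)\to X)\to X$ and $f:W_{AB}\to X$, $$\mathsf{MorphW}\ W_{AB}\,\mathsf{sup}\ \ X\,g\ \ f\ \to\ f = \mathsf{rec}_W\,X\,g .$$
   Context: Type theory: intensional Martin-Löf type theory with universes $\mathcal{U}:\mathcal{U}_0:\cdots$, bottom universe $\mathcal{U}$ impredicative (if $A$ is a type in any universe and $a:A\vdash B:\mathcal{U}$ then $\prod_{a:A}B:\mathcal{U}$), universes closed under $\Sigma$ and identity types; $\pi_1,\pi_2$ projections, $f\circ g := \lambda x.f(g\,x)$. Axioms: function extensionality and UIP. Fix $A:\mathcal{U}$, $B:A\to\mathcal{U}$. $W^*_{AB} := \prod_{X:\mathcal{U}}\big(\prod_{a:A}(B(a)\to X)\to X\big)\to X$; $\mathsf{sup}^*\,a\,r := \lambda X\,g.\ g\,a\,(\lambda b.\ r\,b\,X\,g)$; $\mathsf{rec}^*_W\,X\,g\,w := w\,X\,g$. For $g:\prod_{a:A}(B(a)\to X)\to X$, $g':\prod_{a:A}(B(a)\to Y)\to Y$, $f:X\to Y$: $\mathsf{MorphW}\,X\,g\ Y\,g'\ f := \prod_{a:A}\prod_{t:B(a)\to X} f(g\,a\,t) = g'\,a\,(f\circ t)$. $\mathsf{LimW}\,w := \prod_{X,Y:\mathcal{U}}\prod_{g,g'}\prod_{f:X\to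 Y}\mathsf{MorphW}\,X\,g\ Y\,g'\ f\to f(\mathsf{rec}^*_W\,X\,g\,w) = \mathsf{rec}^*_W\,Y\,g'\,w$. $W_{AB} := \sum_{w:W^*_{AB}}\mathsf{LimW}\,w$. With a proof $p:\prod_{a}\prod_{r:B(a)\to W_{AB}}\mathsf{LimW}(\mathsf{sup}^*\,a\,(\pi_1\circ r))$ (which exists): $\mathsf{sup}\,a\,r := \langle\mathsf{sup}^*\,a\,(\pi_1\circ r), p\,a\,r\rangle$, $\mathsf{rec}_W\,X\,g\,w := \mathsf{rec}^*_W\,X\,g\,(\pi_1 w)$. -}

module Defs where

open import Level using (Level)
open import Agda.Primitive using (Setω)
open import Data.Product using (Σ; _,_; proj₁; proj₂)
open import Function using (_∘_)
open import Function.Bundles using (_↔_)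
open import Relation.Binary.PropositionalEquality using (_≡_)

-- An impredicative bottom universe 𝒰 (Tarski style: codes U, decoding El),
-- closed under Σ and identity types, and impredicative: a Π-type over a
-- type T in ANY universe (any Agda level) of a 𝒰-valued family is (up to
-- equivalence) again in 𝒰.  Agda has no impredicative universe, so the
-- theorem is stated for every such universe.
record ImpUniverse : Setω where
  field
    U   : Set
    El  : U → Set
    Π̂   : ∀ {ℓ} (T : Set ℓ) → (T → U) → U
    Π-iso : ∀ {ℓ} (T : Set ℓ) (P : T → U) → El (Π̂ T P) ↔ ((t : T) → El (P t))
    Σ̂   : (X : U) → (El X → U) → U
    Σ-iso : (X : U) (P : El X → U) → El (Σ̂ X P) ↔ Σ (El X) (El ∘ P)
    Id̂  : (X : U) → El X → El X → U
    Id-iso : (X : U) (x y : El X) → El (Id̂ X x y) ↔ (x ≡ y)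

module WDefs (𝓤 : ImpUniverse) (A : ImpUniverse.U 𝓤)
             (B : ImpUniverse.El 𝓤 A → ImpUniverse.U 𝓤) where
  open ImpUniverse 𝓤

  Alg : ∀ {ℓ} → Set ℓ → Set ℓ
  Alg X = (a : El A) → (El (B a) → X) → X

  W* : Set
  W* = (X : U) → Alg (El X) → El X

  sup* : (a : El A) → (El (B a) → W*) → W*
  sup* a r = λ X g → g a (λ b → r b X g)

  rec*W : (X : U) → Alg (El X) → W* → El X
  rec*W X g w = w X g

  MorphW : ∀ {ℓ ℓ'} (X : Set ℓ) (g : Alg X) (Y : Set ℓ') (g' : Alg Y)
           (f : X → Y) → Set _
  MorphW X g Y g' f =
    (a : El A) (t : El (B a) → X) → f (g a t) ≡ g' a (f ∘ t)

  LimW : W* → Set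
  LimW w = (X Y : U) (g : Alg (El X)) (g' : Alg (El Y)) (f : El X → El Y) →
           MorphW (El X) g (El Y) g' f → f (rec*W X g w) ≡ rec*W Y g' w

  W : Set
  W = Σ W* LimW

  -- the (existing) proof p is taken as a parameter
  SupLim : Set
  SupLim = (a : El A) (r : El (B a) → W) → LimW (sup* a (proj₁ ∘ r))

  sup : SupLim → Alg W
  sup p a r = sup* a (proj₁ ∘ r) , p a r

  recW : (X : U) → Alg (El X) → W → El X
  recW X g w = rec*W X g (proj₁ w)

{-# OPTIONS --with-K #-}
-- By impredicativity W
-- is a retract of a small type Ŵ, which inherits an algebra structure ŝup,
-- so every w : W can be interpreted in Ŵ.  Naturality of w applied to the
-- evaluation morphisms recW Y h shows that this interpretation of w is w
-- itself; naturality applied to f ∘ to then gives f w ≡ recW X g w for any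
-- algebra morphism f out of W.
module Submission where

open import Defs
open import Axiom.Extensionality.Propositional using (Extensionality)
open import Axiom.UniquenessOfIdentityProofs.WithK using (uip)
open import Data.Product using (Σ; _,_; proj₁; proj₂)
open import Data.Product.Properties using (Σ-≡,≡→≡)
open import Data.Product.Function.Dependent.Propositional using (Σ-↩)
open import Function using (_∘_; _↩_; mk↩; LeftInverse)
open import Function.Construct.Composition using (_↩-∘_)
open import Function.Construct.Identity using (↩-id)
open import Function.Properties.Inverse using (↔⇒↩)
open import Relation.Binary.PropositionalEquality using (_≡_; refl; sym; trans; cong; module ≡-Reasoning)

open LeftInverse using (to; from; strictlyInverseˡ)

Π-↩ : ∀ {ℓ a b} {T : Set ℓ} {P : T → Set a} {Q : T → Set b} →
      Extensionality ℓ b → (∀ t → P t ↩ Q t) →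
      ((t : T) → P t) ↩ ((t : T) → Q t)
Π-↩ funext P↩Q = mk↩ {to = λ h t → to (P↩Q t) (h t)} {from = λ h t → from (P↩Q t) (h t)}
  λ { refl → funext λ t → strictlyInverseˡ (P↩Q t) _ }

module SmallTypes (𝓤 : ImpUniverse) (funext : ∀ {a b} → Extensionality a b) where
  open ImpUniverse 𝓤

  Π̂-↩ : ∀ {ℓ} {T : Set ℓ} {P : T → U} {Q : T → Set} →
        (∀ t → El (P t) ↩ Q t) → El (Π̂ T P) ↩ ((t : T) → Q t)
  Π̂-↩ P↩Q = Π-↩ funext P↩Q ↩-∘ ↔⇒↩ (Π-iso _ _)

  Σ̂-↩ : {X : U} {P : El X → U} {S : Set} {Q : S → Set} (X↩S : El X ↩ S) →
        (∀ {x} → El (P x) ↩ Q (to X↩S x)) → El (Σ̂ X P) ↩ Σ S Q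
  Σ̂-↩ X↩S P↩Q = Σ-↩ X↩S P↩Q ↩-∘ ↔⇒↩ (Σ-iso _ _)

  Id̂-↩ : {X : U} {x y : El X} → El (Id̂ X x y) ↩ (x ≡ y)
  Id̂-↩ = ↔⇒↩ (Id-iso _ _ _)

module WIsSmall (𝓤 : ImpUniverse) (funext : ∀ {a b} → Extensionality a b)
                (A : ImpUniverse.U 𝓤) (B : ImpUniverse.El 𝓤 A → ImpUniverse.U 𝓤) where
  open ImpUniverse 𝓤
  open WDefs 𝓤 A B
  open SmallTypes 𝓤 funext

  Ŵ* : U
  Ŵ* = Π̂ U λ X → Π̂ (Alg (El X)) λ _ → X

  Ŵ*↩W* : El Ŵ* ↩ W*
  Ŵ*↩W* = Π̂-↩ λ _ → Π̂-↩ λ _ → ↩-id _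

  L̂imW : W* → U
  L̂imW w = Π̂ U λ X → Π̂ U λ Y → Π̂ (Alg (El X)) λ g → Π̂ (Alg (El Y)) λ g' →
           Π̂ (El X → El Y) λ f → Π̂ (MorphW (El X) g (El Y) g' f) λ _ →
           Id̂ Y (f (rec*W X g w)) (rec*W Y g' w)

  L̂imW↩LimW : (w : W*) → El (L̂imW w) ↩ LimW w
  L̂imW↩LimW w = Π̂-↩ λ _ → Π̂-↩ λ _ → Π̂-↩ λ _ → Π̂-↩ λ _ → Π̂-↩ λ _ → Π̂-↩ λ _ → Id̂-↩

  Ŵ : U
  Ŵ = Σ̂ Ŵ* (L̂imW ∘ to Ŵ*↩W*)

  Ŵ↩W : El Ŵ ↩ W
  Ŵ↩W = Σ̂-↩ Ŵ*↩W* (L̂imW↩LimW _)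

module Morphisms (𝓤 : ImpUniverse) (A : ImpUniverse.U 𝓤)
                 (B : ImpUniverse.El 𝓤 A → ImpUniverse.U 𝓤) where
  open WDefs 𝓤 A B

  MorphW-∘ : ∀ {ℓ ℓ' ℓ''} {X : Set ℓ} {Y : Set ℓ'} {Z : Set ℓ''}
             {g : Alg X} {g' : Alg Y} {g'' : Alg Z} {f : X → Y} {f' : Y → Z} →
             MorphW X g Y g' f → MorphW Y g' Z g'' f' → MorphW X g Z g'' (f' ∘ f)
  MorphW-∘ {f' = f'} m m' a t = trans (cong f' (m a t)) (m' a _)

module Uniqueness (𝓤 : ImpUniverse) (funext : ∀ {a b} → Extensionality a b)
                  (A : ImpUniverse.U 𝓤) (B : ImpUniverse.El 𝓤 A → ImpUniverse.U 𝓤)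
                  (p : WDefs.SupLim 𝓤 A B) where
  open ImpUniverse 𝓤
  open WDefs 𝓤 A B
  open Morphisms 𝓤 A B
  open ≡-Reasoning

  LimW-irrelevant : (w : W*) (l l' : LimW w) → l ≡ l'
  LimW-irrelevant w l l' =
    funext λ X → funext λ Y → funext λ g → funext λ g' → funext λ f → funext λ m →
    uip (l X Y g g' f m) (l' X Y g g' f m)

  W-≡ : {v w : W} → proj₁ v ≡ proj₁ w → v ≡ w
  W-≡ {v} {w} e = Σ-≡,≡→≡ (e , LimW-irrelevant (proj₁ w) _ (proj₂ w))

  recW-isMorphW : (Y : U) (h : Alg (El Y)) → MorphW W (sup p) (El Y) h (recW Y h)
  recW-isMorphW Y h a t = refl

  module _ (Ŵ : U) (Ŵ↩W : El Ŵ ↩ W) where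

    ŝup : Alg (El Ŵ)
    ŝup a t = from Ŵ↩W (sup p a (to Ŵ↩W ∘ t))

    to-isMorphW : MorphW (El Ŵ) ŝup W (sup p) (to Ŵ↩W)
    to-isMorphW a t = strictlyInverseˡ Ŵ↩W _

    interpret : W → El Ŵ
    interpret w = rec*W Ŵ ŝup (proj₁ w)

    morphW-after-interpret : (w : W) {Y : U} {h : Alg (El Y)} (k : W → El Y) →
      MorphW W (sup p) (El Y) h k → k (to Ŵ↩W (interpret w)) ≡ recW Y h w
    morphW-after-interpret (w , l) {Y} {h} k m =
      l Ŵ Y ŝup h (k ∘ to Ŵ↩W)
        (MorphW-∘ {g' = sup p} {h} {to Ŵ↩W} {k} to-isMorphW m)

    to-interpret : (w : W) → to Ŵ↩W (interpret w) ≡ w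
    to-interpret w = W-≡ (funext λ Y → funext λ h →
      morphW-after-interpret w (recW Y h) (recW-isMorphW Y h))

    MorphW-unique : (X : U) (g : Alg (El X)) (f : W → El X) →
      MorphW W (sup p) (El X) g f → f ≡ recW X g
    MorphW-unique X g f m = funext λ w → begin
      f w                         ≡⟨ cong f (sym (to-interpret w)) ⟩
      f (to Ŵ↩W (interpret w))    ≡⟨ morphW-after-interpret w f m ⟩
      recW X g w                  ∎

theorem8p4p8 : (𝓤 : ImpUniverse) →
    (funext : ∀ {a b} → Extensionality a b) →
    (A : ImpUniverse.U 𝓤) (B : ImpUniverse.El 𝓤 A → ImpUniverse.U 𝓤) →
    (p : WDefs.SupLim 𝓤 A B) →
    (X : ImpUniverse.U 𝓤) (g : WDefs.Alg 𝓤 A B (ImpUniverse.El 𝓤 X)) →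
    (f : WDefs.W 𝓤 A B → ImpUniverse.El 𝓤 X) →
    WDefs.MorphW 𝓤 A B (WDefs.W 𝓤 A B) (WDefs.sup 𝓤 A B p) (ImpUniverse.El 𝓤 X) g f →
    f ≡ WDefs.recW 𝓤 A B X g
theorem8p4p8 𝓤 funext A B p = Uniqueness.MorphW-unique 𝓤 funext A B p Ŵ Ŵ↩W
  where open WIsSmall 𝓤 funext A B
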